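{- Let $G\in\mathcal{G}_{n,d}$ and let $v_1v_2\cdots v_kv_1$ be an induced cycle in $G$ with $k\geq 6$, on vertex set $U=\{v_1,\dots,v_k\}$. Then for every permutation $\sigma$ of $U$, there is a sequence of $\Delta$-switches transforming $G$ into the graph obtained from $G$ by replacing the edges $v_iv_{i+1}$ ($i=1,\dots,k$, indices mod $k$) with the edges $\sigma(v_i)\sigma(v_{i+1})$, all other edges being unchanged. That is, $\Delta$-switches can be used to permute the vertices of the cycle arbitrarily.
   Context: All graphs are simple. $\mathcal{G}_{n,d}$ is the set of $d$-regular graphs on vertex set $[n]$. A cycle on vertex set $U$ is induced if $G[U]$ is exactly that cycle. A $\Delta^+$-switch: if $p,x,y,w,z$ are distinct vertices with $yx, xp, pw, wz\in E$ and $xw, yz\notin E$, delete $xy$, $wz$ and insert $xw$, $yz$. A $\Delta^-$-switch is the reverse: if $p,x,y,w,z$ are distinct, $G$ contains the triangle $p,x,w$ and the edge $yz$, and $xy,wz\notin E$, delete $xw$, $yz$ and insert $xy$, $wz$. A $\Delta$-switch is either of these. -}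

module Defs where

open import Data.Nat using (ℕ; zero; suc)
open import Data.Nat.DivMod using (_mod_)
open import Data.Fin using (Fin; toℕ)
open import Data.Bool using (Bool; true; false; if_then_else_)
open import Data.List using (List; map; allFin)
open import Data.Nat.ListAction using (sum)
open import Data.Product using (_×_; ∃-syntax)
open import Data.Sum using (_⊎_)
open import Relation.Nullary using (¬_)
open import Relation.Binary.PropositionalEquality using (_≡_)
open import Function.Bundles using (_⇔_)

Graph : ℕ → Set
Graph n = Fin n → Fin n → Bool

IsSimple : ∀ {n} → Graph n → Set
IsSimple {n} G = (∀ a b → G a b ≡ G b a) × (∀ a → G a a ≡ false)

degree : ∀ {n} → Graph n → Fin n → ℕ
degree {n} G v = sum (map (λ u → if G v u then 1 else 0) (allFin n))

Regular : ∀ {n} → ℕ → Graph n → Set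
Regular d G = ∀ v → degree G v ≡ d

SamePair : ∀ {n} → Fin n → Fin n → Fin n → Fin n → Set
SamePair a b x y = (a ≡ x × b ≡ y) ⊎ (a ≡ y × b ≡ x)

Swap : ∀ {n} → Graph n → Graph n →
       (x₁ y₁ x₂ y₂ u₁ v₁ u₂ v₂ : Fin n) → Set
Swap G H x₁ y₁ x₂ y₂ u₁ v₁ u₂ v₂ = ∀ a b →
  (H a b ≡ true) ⇔
  ((G a b ≡ true × ¬ SamePair a b x₁ y₁ × ¬ SamePair a b x₂ y₂)
   ⊎ SamePair a b u₁ v₁ ⊎ SamePair a b u₂ v₂)

Distinct5 : ∀ {n} → (p x y w z : Fin n) → Set
Distinct5 p x y w z =
  ¬ p ≡ x × ¬ p ≡ y × ¬ p ≡ w × ¬ p ≡ z × ¬ x ≡ y ×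
  ¬ x ≡ w × ¬ x ≡ z × ¬ y ≡ w × ¬ y ≡ z × ¬ w ≡ z

ΔPlus : ∀ {n} → Graph n → Graph n → Set
ΔPlus G H = ∃[ p ] ∃[ x ] ∃[ y ] ∃[ w ] ∃[ z ]
  (Distinct5 p x y w z ×
   G y x ≡ true × G x p ≡ true × G p w ≡ true × G w z ≡ true ×
   G x w ≡ false × G y z ≡ false ×
   Swap G H x y w z x w y z)

ΔMinus : ∀ {n} → Graph n → Graph n → Set
ΔMinus G H = ∃[ p ] ∃[ x ] ∃[ y ] ∃[ w ] ∃[ z ]
  (Distinct5 p x y w z ×
   G p x ≡ true × G x w ≡ true × G p w ≡ true × G y z ≡ true ×
   G x y ≡ false × G w z ≡ false ×
   Swap G H x w y z x y w z)

ΔSwitch : ∀ {n} → Graph n → Graph n → Set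
ΔSwitch G H = ΔPlus G H ⊎ ΔMinus G H

data Reach {n} : Graph n → Graph n → Set where
  done : ∀ {G H} → (∀ a b → G a b ≡ H a b) → Reach G H
  step : ∀ {G G′ H} → ΔSwitch G G′ → Reach G′ H → Reach G H

next : ∀ {k} → Fin k → Fin k
next {suc m} i = suc (toℕ i) mod suc m

CycleEdge : ∀ {n k} → (Fin k → Fin n) → Fin n → Fin n → Set
CycleEdge v a b = ∃[ i ] SamePair a b (v i) (v (next i))

InducedCycle : ∀ {n k} → Graph n → (Fin k → Fin n) → Set
InducedCycle {k = k} G v =
  (∀ i j → v i ≡ v j → i ≡ j) ×
  (∀ i j → (G (v i) (v j) ≡ true) ⇔ (j ≡ next i ⊎ i ≡ next j))

ReplaceCycle : ∀ {n k} → Graph n → (v w : Fin k → Fin n) → Graph n → Set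
ReplaceCycle G v w H = ∀ a b →
  (H a b ≡ true) ⇔ ((G a b ≡ true × ¬ CycleEdge v a b) ⊎ CycleEdge w a b)

-- A Δ⁺-switch on the cycle q x y c z w ⋯ that deletes qx and cz and inserts xc and qz splits it
-- into the triangle xyc and the cycle q z w ⋯; the vertex w, which exists because k ≥ 6, keeps qz
-- from already being an edge.  The triangle xyc is also the triangle yxc, so the cycle
-- q y x c z w ⋯ splits into the same graph, and since a Δ⁻-switch undoes a Δ⁺-switch, two
-- Δ-switches exchange two cyclically adjacent vertices.  Adjacent transpositions and rotations of
-- the cycle generate all permutations of its vertices.
module Submission where

open import Defs
open import Data.Nat using (ℕ; zero; suc; _≤_; _%_; s≤s)
open import Data.Nat.Properties using (suc-injective)
open import Data.Nat.DivMod using (_mod_; m<n⇒m%n≡m; n%n≡0)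
open import Data.Bool using (Bool; true; false)
open import Data.Bool.Properties using (¬-not) renaming (_≟_ to _≟ᵇ_)
open import Data.Empty using (⊥-elim)
open import Data.Fin using (Fin; zero; suc; toℕ; inject₁; fromℕ) renaming (_≟_ to _≟ᶠ_)
open import Data.Fin.Properties using (toℕ-fromℕ<; toℕ-inject₁; toℕ-fromℕ; toℕ<n; toℕ-injective; any?)
open import Data.Fin.Permutation using (Permutation′; _⟨$⟩ʳ_; _⟨$⟩ˡ_; inverseˡ; inverseʳ)
open import Data.List
  using (List; []; _∷_; _++_; [_]; _∷ʳ_; map; zip; tabulate; length; initLast; _∷ʳ′_)
open import Data.List.Properties
  using (length-++-comm; ++-assoc; ++-identityʳ; tabulate-cong; length-tabulate; map-tabulate)
open import Data.List.Membership.Propositional using (_∈_)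
open import Data.List.Membership.Propositional.Properties using (∈-tabulate⁻; ∈-tabulate⁺)
open import Data.List.Membership.Propositional.Properties.WithK using (unique∧set⇒bag)
open import Data.List.Relation.Unary.Any using (Any; here; there)
import Data.List.Relation.Unary.Any as Any
import Data.List.Relation.Unary.Any.Properties as Any
open import Data.List.Relation.Unary.All using (All; []; _∷_)
open import Data.List.Relation.Unary.All.Properties using (All¬⇒¬Any; ++⁺)
open import Data.List.Relation.Unary.AllPairs using (_∷_)
open import Data.List.Relation.Unary.Unique.Propositional using (Unique)
import Data.List.Relation.Unary.Unique.Propositional.Properties as Unique
open import Data.List.Relation.Binary.BagAndSetEquality using (∼bag⇒↭)
open import Data.List.Relation.Binary.Permutation.Propositional
  using (_↭_; ↭-refl; ↭-trans; ↭-sym; ↭-prep; ↭-swap; ↭-reflexive; ↭⇒↭ₛ; module PermutationReasoning)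
import Data.List.Relation.Binary.Permutation.Propositional as ↭
open import Data.List.Relation.Binary.Permutation.Propositional.Properties
  using (Any-resp-↭; ∈-resp-↭; ∷↭∷ʳ; shift; shifts; ++-comm; ++⁺ˡ; ↭-length; map⁺)
import Data.List.Relation.Binary.Permutation.Setoid.Properties as PermutationSetoid
open import Data.Product using (_×_; _,_; proj₁; proj₂)
open import Data.Sum using (_⊎_; inj₁; inj₂)
import Data.Sum as Sum
open import Function using (_∘_; id; case_of_)
open import Function.Bundles using (_⇔_; mk⇔; Equivalence)
open import Relation.Nullary using (¬_; Dec; does; yes; no)
open import Relation.Nullary.Decidable using (_×-dec_; _⊎-dec_; ¬?)
open import Relation.Binary.PropositionalEquality hiding ([_])

open Equivalence using (to; from)

private
  variable
    A : Set
    n : ℕ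

true⇔true⇒≡ : ∀ {x y : Bool} → (x ≡ true ⇔ y ≡ true) → x ≡ y
true⇔true⇒≡ {true} e = sym (to e refl)
true⇔true⇒≡ {false} {true} e = from e refl
true⇔true⇒≡ {false} {false} e = refl

does⇔ : ∀ {P : Set} (P? : Dec P) → (does P? ≡ true) ⇔ P
does⇔ (yes p) = mk⇔ (λ _ → p) (λ _ → refl)
does⇔ (no ¬p) = mk⇔ (λ ()) (⊥-elim ∘ ¬p)

SamePair-sym : ∀ {a b x y : Fin n} → SamePair a b x y → SamePair b a x y
SamePair-sym (inj₁ (refl , refl)) = inj₂ (refl , refl)
SamePair-sym (inj₂ (refl , refl)) = inj₁ (refl , refl)

SamePair-flip : ∀ {a b x y : Fin n} → SamePair a b x y → SamePair a b y x
SamePair-flip (inj₁ p) = inj₂ p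
SamePair-flip (inj₂ p) = inj₁ p

samePair? : (a b x y : Fin n) → Dec (SamePair a b x y)
samePair? a b x y = ((a ≟ᶠ x) ×-dec (b ≟ᶠ y)) ⊎-dec ((a ≟ᶠ y) ×-dec (b ≟ᶠ x))

apartˡ : ∀ {a b x y : Fin n} → a ≢ x → a ≢ y → ¬ SamePair a b x y
apartˡ a≢x _ (inj₁ (a≡x , _)) = a≢x a≡x
apartˡ _ a≢y (inj₂ (a≡y , _)) = a≢y a≡y

apartʳ : ∀ {a b x y : Fin n} → b ≢ x → b ≢ y → ¬ SamePair a b x y
apartʳ _ b≢y (inj₁ (_ , b≡y)) = b≢y b≡y
apartʳ b≢x _ (inj₂ (_ , b≡x)) = b≢x b≡x

CycleEdge-sym : ∀ {k} {v : Fin k → Fin n} {a b} → CycleEdge v a b → CycleEdge v b a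
CycleEdge-sym (i , s) = i , SamePair-sym s

cycleEdge? : ∀ {k} (v : Fin k → Fin n) a b → Dec (CycleEdge v a b)
cycleEdge? v a b = any? λ i → samePair? a b (v i) (v (next i))

Joins : List (Fin n × Fin n) → Fin n → Fin n → Set
Joins es a b = Any (λ e → SamePair a b (proj₁ e) (proj₂ e)) es

Joins-sym : ∀ {es : List (Fin n × Fin n)} {a b} → Joins es a b → Joins es b a
Joins-sym = Any.map SamePair-sym

joins? : (es : List (Fin n × Fin n)) (a b : Fin n) → Dec (Joins es a b)
joins? es a b = Any.any? (λ e → samePair? a b (proj₁ e) (proj₂ e)) es

infix 4 _≈_
_≈_ : List (Fin n × Fin n) → List (Fin n × Fin n) → Set
es ≈ es′ = (∀ {a b} → Joins es a b → Joins es′ a b) × (∀ {a b} → Joins es′ a b → Joins es a b)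

≈-trans : ∀ {es es′ es″ : List (Fin n × Fin n)} → es ≈ es′ → es′ ≈ es″ → es ≈ es″
≈-trans (f , g) (f′ , g′) = f′ ∘ f , g ∘ g′

↭⇒≈ : ∀ {es es′ : List (Fin n × Fin n)} → es ↭ es′ → es ≈ es′
↭⇒≈ p = Any-resp-↭ p , Any-resp-↭ (↭-sym p)

≈-∷ : ∀ {es es′ : List (Fin n × Fin n)} {e} → es ≈ es′ → e ∷ es ≈ e ∷ es′
≈-∷ (f , g) = lift f , lift g
  where
    lift : ∀ {e us vs} → (∀ {a b} → Joins us a b → Joins vs a b) →
           ∀ {a b} → Joins (e ∷ us) a b → Joins (e ∷ vs) a b
    lift h (here s) = here s
    lift h (there j) = there (h j)

≈-flip : ∀ {x y : Fin n} {es} → (x , y) ∷ es ≈ (y , x) ∷ es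
≈-flip = flip , flip
  where
    flip : ∀ {x y es a b} → Joins ((x , y) ∷ es) a b → Joins ((y , x) ∷ es) a b
    flip (here s) = here (SamePair-flip s)
    flip (there j) = there j

zip-All : ∀ {P : A → Set} {Q : A × A → Set} → (∀ {x y} → P x → P y → Q (x , y)) →
          ∀ {xs ys} → All P xs → All P ys → All Q (zip xs ys)
zip-All f [] _ = []
zip-All f (_ ∷ _) [] = []
zip-All f (px ∷ pxs) (py ∷ pys) = f px py ∷ zip-All f pxs pys

ring : List A → List (A × A)
ring [] = []
ring (x ∷ xs) = zip (x ∷ xs) (xs ∷ʳ x)

zip-∷ʳ : ∀ {B : Set} (xs : List A) (ys : List B) {x y} → length xs ≡ length ys →
         zip (xs ∷ʳ x) (ys ∷ʳ y) ≡ zip xs ys ∷ʳ (x , y)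
zip-∷ʳ [] [] _ = refl
zip-∷ʳ (x ∷ xs) (y ∷ ys) eq = cong ((x , y) ∷_) (zip-∷ʳ xs ys (suc-injective eq))

ring-rotate : (x : A) (xs : List A) → ring (x ∷ xs) ↭ ring (xs ∷ʳ x)
ring-rotate x [] = ↭-refl
ring-rotate x (y ∷ ys) = begin
  (x , y) ∷ zip (y ∷ ys) (ys ∷ʳ x)    ↭⟨ ∷↭∷ʳ (x , y) (zip (y ∷ ys) (ys ∷ʳ x)) ⟩
  zip (y ∷ ys) (ys ∷ʳ x) ∷ʳ (x , y)   ≡⟨ zip-∷ʳ (y ∷ ys) (ys ∷ʳ x) (sym (length-++-comm ys [ x ])) ⟨
  ring (y ∷ ys ∷ʳ x)                  ∎
  where open PermutationReasoning

ring-++-comm : (xs ys : List A) → ring (xs ++ ys) ↭ ring (ys ++ xs)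
ring-++-comm [] ys = ↭-reflexive (cong ring (sym (++-identityʳ ys)))
ring-++-comm (x ∷ xs) ys = begin
  ring (x ∷ xs ++ ys)        ↭⟨ ring-rotate x (xs ++ ys) ⟩
  ring ((xs ++ ys) ∷ʳ x)     ≡⟨ cong ring (++-assoc xs ys [ x ]) ⟩
  ring (xs ++ ys ∷ʳ x)       ↭⟨ ring-++-comm xs (ys ∷ʳ x) ⟩
  ring ((ys ∷ʳ x) ++ xs)     ≡⟨ cong ring (++-assoc ys [ x ] xs) ⟩
  ring (ys ++ x ∷ xs)        ∎
  where open PermutationReasoning

triangle-reverse : (x y c : Fin n) (es : List (Fin n × Fin n)) →
                   ring (x ∷ y ∷ [ c ]) ++ es ≈ ring (y ∷ x ∷ [ c ]) ++ es
triangle-reverse x y c es =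
  ≈-trans ≈-flip (≈-trans (≈-∷ ≈-flip) (≈-trans (≈-∷ (≈-∷ ≈-flip))
    (↭⇒≈ (↭-prep (y , x) (↭-swap (c , y) (x , c) ↭-refl)))))

next-inject₁ : ∀ {m} (i : Fin m) → next {suc m} (inject₁ i) ≡ suc i
next-inject₁ {m} i = toℕ-injective (begin
  toℕ (suc (toℕ (inject₁ i)) mod suc m)  ≡⟨ toℕ-fromℕ< _ ⟩
  suc (toℕ (inject₁ i)) % suc m          ≡⟨ cong (λ t → suc t % suc m) (toℕ-inject₁ i) ⟩
  suc (toℕ i) % suc m                    ≡⟨ m<n⇒m%n≡m (s≤s (toℕ<n i)) ⟩
  suc (toℕ i)                            ∎)
  where open ≡-Reasoning

next-fromℕ : ∀ m → next {suc m} (fromℕ m) ≡ zero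
next-fromℕ m = toℕ-injective (begin
  toℕ (suc (toℕ (fromℕ m)) mod suc m)  ≡⟨ toℕ-fromℕ< _ ⟩
  suc (toℕ (fromℕ m)) % suc m          ≡⟨ cong (λ t → suc t % suc m) (toℕ-fromℕ m) ⟩
  suc m % suc m                        ≡⟨ n%n≡0 (suc m) ⟩
  0                                    ∎)
  where open ≡-Reasoning

tabulate-∷ʳ : ∀ {m} (f : Fin (suc m) → A) → tabulate f ≡ tabulate (f ∘ inject₁) ∷ʳ f (fromℕ m)
tabulate-∷ʳ {m = zero} f = refl
tabulate-∷ʳ {m = suc m} f = cong (f zero ∷_) (tabulate-∷ʳ (f ∘ suc))

zip-tabulate : ∀ {B : Set} {m} (f : Fin m → A) (g : Fin m → B) →
               zip (tabulate f) (tabulate g) ≡ tabulate (λ i → f i , g i)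
zip-tabulate {m = zero} f g = refl
zip-tabulate {m = suc m} f g = cong ((f zero , g zero) ∷_) (zip-tabulate (f ∘ suc) (g ∘ suc))

ring-tabulate : ∀ {k} (w : Fin k → A) → ring (tabulate w) ≡ tabulate (λ i → w i , w (next i))
ring-tabulate {k = zero} w = refl
ring-tabulate {k = suc m} w = begin
  ring (tabulate w)
    ≡⟨ cong (zip (tabulate w)) (cong₂ _∷ʳ_ (tabulate-cong (cong w ∘ sym ∘ next-inject₁))
                                            (cong w (sym (next-fromℕ m)))) ⟩
  zip (tabulate w) (tabulate (w ∘ next ∘ inject₁) ∷ʳ w (next (fromℕ m)))
    ≡⟨ cong (zip (tabulate w)) (tabulate-∷ʳ (w ∘ next)) ⟨
  zip (tabulate w) (tabulate (w ∘ next))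
    ≡⟨ zip-tabulate w (w ∘ next) ⟩
  tabulate (λ i → w i , w (next i)) ∎
  where open ≡-Reasoning

Joins-ring-tabulate : ∀ {k} (w : Fin k → Fin n) {a b} → Joins (ring (tabulate w)) a b ⇔ CycleEdge w a b
Joins-ring-tabulate w {a} {b} = mk⇔
  (λ j → Any.tabulate⁻ (subst (λ es → Joins es a b) (ring-tabulate w) j))
  (λ (i , s) → subst (λ es → Joins es a b) (sym (ring-tabulate w)) (Any.tabulate⁺ i s))

tabulate-↭ : ∀ {k} (π : Permutation′ k) (f : Fin k → A) → tabulate f ↭ tabulate (f ∘ (π ⟨$⟩ʳ_))
tabulate-↭ π f = begin
  tabulate f                  ≡⟨ map-tabulate id f ⟨
  map f (tabulate id)         ↭⟨ map⁺ f (∼bag⇒↭ (unique∧set⇒bag (Unique.tabulate⁺ id)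
                                                  (Unique.tabulate⁺ π-injective) same-elements)) ⟩
  map f (tabulate (π ⟨$⟩ʳ_))  ≡⟨ map-tabulate (π ⟨$⟩ʳ_) f ⟩
  tabulate (f ∘ (π ⟨$⟩ʳ_))    ∎
  where
    open PermutationReasoning

    π-injective : ∀ {i j} → π ⟨$⟩ʳ i ≡ π ⟨$⟩ʳ j → i ≡ j
    π-injective eq = trans (sym (inverseˡ π)) (trans (cong (π ⟨$⟩ˡ_) eq) (inverseˡ π))

    same-elements : ∀ {i} → (i ∈ tabulate id) ⇔ (i ∈ tabulate (π ⟨$⟩ʳ_))
    same-elements {i} = mk⇔ (λ _ → subst (_∈ tabulate _) (inverseʳ π) (∈-tabulate⁺ (π ⟨$⟩ˡ i)))
                            (λ _ → ∈-tabulate⁺ i)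

Reach-trans : ∀ {A B C : Graph n} → Reach A B →
              (∀ {B′} → (∀ a b → B′ a b ≡ B a b) → Reach B′ C) → Reach A C
Reach-trans (done A≗B) k = k A≗B
Reach-trans (step s r) k = step s (Reach-trans r k)

ΔPlus⇒ΔMinus : ∀ {G H : Graph n} → (∀ a b → G a b ≡ G b a) → ΔPlus G H → ΔMinus H G
ΔPlus⇒ΔMinus {G = G} {H} G-sym
  (p , x , y , w , z , distinct@(p≢x , p≢y , p≢w , p≢z , x≢y , x≢w , x≢z , y≢w , y≢z , w≢z) ,
   Gyx , Gxp , Gpw , Gwz , Gxw , Gyz , switch) =
  p , x , y , w , z , distinct , Hpx , Hxw , Hpw , Hyz , Hxy , Hwz , switch⁻¹
  where
    G-along : ∀ {a b u v} → SamePair a b u v → G a b ≡ G u v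
    G-along (inj₁ (refl , refl)) = refl
    G-along (inj₂ (refl , refl)) = G-sym _ _

    nonEdge : ∀ {a b u v} → G u v ≡ false → G a b ≡ true → ¬ SamePair a b u v
    nonEdge Guv Gab s with () ← trans (sym Gab) (trans (G-along s) Guv)

    kept : ∀ {a b} → G a b ≡ true → ¬ SamePair a b x y → ¬ SamePair a b w z → H a b ≡ true
    kept g ¬s₁ ¬s₂ = from (switch _ _) (inj₁ (g , ¬s₁ , ¬s₂))

    Hpx : H p x ≡ true
    Hpx = kept (trans (G-sym p x) Gxp) (apartˡ p≢x p≢y) (apartˡ p≢w p≢z)

    Hxw : H x w ≡ true
    Hxw = from (switch x w) (inj₂ (inj₁ (inj₁ (refl , refl))))

    Hpw : H p w ≡ true
    Hpw = kept Gpw (apartˡ p≢x p≢y) (apartˡ p≢w p≢z)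

    Hyz : H y z ≡ true
    Hyz = from (switch y z) (inj₂ (inj₂ (inj₁ (refl , refl))))

    Hxy : H x y ≡ false
    Hxy = ¬-not λ h → case to (switch x y) h of λ where
      (inj₁ (_ , ¬xy , _)) → ¬xy (inj₁ (refl , refl))
      (inj₂ (inj₁ s)) → apartʳ (≢-sym x≢y) y≢w s
      (inj₂ (inj₂ s)) → apartˡ x≢y x≢z s

    Hwz : H w z ≡ false
    Hwz = ¬-not λ h → case to (switch w z) h of λ where
      (inj₁ (_ , _ , ¬wz)) → ¬wz (inj₁ (refl , refl))
      (inj₂ (inj₁ s)) → apartʳ (≢-sym x≢z) (≢-sym w≢z) s
      (inj₂ (inj₂ s)) → apartˡ (≢-sym y≢w) w≢z s

    switch⁻¹ : Swap H G x w y z x y w z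
    switch⁻¹ a b = mk⇔ forth back
      where
        forth : G a b ≡ true →
                (H a b ≡ true × ¬ SamePair a b x w × ¬ SamePair a b y z) ⊎
                SamePair a b x y ⊎ SamePair a b w z
        forth g with samePair? a b x y | samePair? a b w z
        ... | yes s | _ = inj₂ (inj₁ s)
        ... | no _ | yes s = inj₂ (inj₂ s)
        ... | no ¬s₁ | no ¬s₂ = inj₁ (kept g ¬s₁ ¬s₂ , nonEdge Gxw g , nonEdge Gyz g)

        back : (H a b ≡ true × ¬ SamePair a b x w × ¬ SamePair a b y z) ⊎
               SamePair a b x y ⊎ SamePair a b w z → G a b ≡ true
        back (inj₂ (inj₁ s)) = trans (G-along s) (trans (G-sym x y) Gyx)
        back (inj₂ (inj₂ s)) = trans (G-along s) Gwz
        back (inj₁ (h , ¬s₁ , ¬s₂)) with to (switch a b) h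
        ... | inj₁ (g , _) = g
        ... | inj₂ (inj₁ s) = ⊥-elim (¬s₁ s)
        ... | inj₂ (inj₂ s) = ⊥-elim (¬s₂ s)

module Realisation {n : ℕ} (Background : Fin n → Fin n → Set)
                   (background? : ∀ a b → Dec (Background a b)) where

  private
    variable
      X Y : Graph n
      a b x₁ y₁ x₂ y₂ u₁ v₁ u₂ v₂ : Fin n
      es es′ rest : List (Fin n × Fin n)

  infix 4 _⊨_
  _⊨_ : Graph n → List (Fin n × Fin n) → Set
  X ⊨ es = ∀ a b → (X a b ≡ true) ⇔ (Joins es a b ⊎ Background a b)

  ⊨-resp-≈ : es ≈ es′ → X ⊨ es → X ⊨ es′
  ⊨-resp-≈ (f , g) X⊨ a b = mk⇔ (Sum.map₁ f ∘ to (X⊨ a b)) (from (X⊨ a b) ∘ Sum.map₁ g)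

  ⊨-resp-≗ : (∀ a b → Y a b ≡ X a b) → X ⊨ es → Y ⊨ es
  ⊨-resp-≗ Y≗X X⊨ a b rewrite Y≗X a b = X⊨ a b

  ⊨-unique : X ⊨ es → Y ⊨ es → ∀ a b → X a b ≡ Y a b
  ⊨-unique X⊨ Y⊨ a b =
    true⇔true⇒≡ (mk⇔ (from (Y⊨ a b) ∘ to (X⊨ a b)) (from (X⊨ a b) ∘ to (Y⊨ a b)))

  ⊨-symmetric : (∀ {a b} → Background a b → Background b a) → X ⊨ es → ∀ a b → X a b ≡ X b a
  ⊨-symmetric {X = X} Background-sym X⊨ a b = true⇔true⇒≡ (mk⇔ (flip a b) (flip b a))
    where
      flip : ∀ a b → X a b ≡ true → X b a ≡ true
      flip a b = from (X⊨ b a) ∘ Sum.map Joins-sym Background-sym ∘ to (X⊨ a b)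

  ⊨-edge : X ⊨ es → Joins es a b → X a b ≡ true
  ⊨-edge X⊨ j = from (X⊨ _ _) (inj₁ j)

  ⊨-nonEdge : X ⊨ es → ¬ Joins es a b → ¬ Background a b → X a b ≡ false
  ⊨-nonEdge X⊨ ¬j ¬β = ¬-not λ e → Sum.[ ¬j , ¬β ] (to (X⊨ _ _) e)

  graph : List (Fin n × Fin n) → Graph n
  graph es a b = does (joins? es a b ⊎-dec background? a b)

  graph-⊨ : graph es ⊨ es
  graph-⊨ {es} a b = does⇔ (joins? es a b ⊎-dec background? a b)

  Absent : Fin n → Fin n → List (Fin n × Fin n) → Set
  Absent x y rest = ∀ {a b} → SamePair a b x y → ¬ (Joins rest a b ⊎ Background a b)

  ⊨-switch : X ⊨ (x₁ , y₁) ∷ (x₂ , y₂) ∷ rest → Y ⊨ (u₁ , v₁) ∷ (u₂ , v₂) ∷ rest →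
             Absent x₁ y₁ rest → Absent x₂ y₂ rest → Swap X Y x₁ y₁ x₂ y₂ u₁ v₁ u₂ v₂
  ⊨-switch {X} {x₁} {y₁} {x₂} {y₂} {rest} {Y} {u₁} {v₁} {u₂} {v₂} X⊨ Y⊨ absent₁ absent₂ a b =
    mk⇔ forth back
    where
      Kept : Set
      Kept = X a b ≡ true × ¬ SamePair a b x₁ y₁ × ¬ SamePair a b x₂ y₂

      kept : Joins rest a b ⊎ Background a b → Kept
      kept k = from (X⊨ a b) (Sum.map₁ (there ∘ there) k) , (λ s → absent₁ s k) , (λ s → absent₂ s k)

      forth : Y a b ≡ true → Kept ⊎ SamePair a b u₁ v₁ ⊎ SamePair a b u₂ v₂
      forth h with to (Y⊨ a b) h
      ... | inj₁ (here s) = inj₂ (inj₁ s)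
      ... | inj₁ (there (here s)) = inj₂ (inj₂ s)
      ... | inj₁ (there (there j)) = inj₁ (kept (inj₁ j))
      ... | inj₂ β = inj₁ (kept (inj₂ β))

      back : Kept ⊎ SamePair a b u₁ v₁ ⊎ SamePair a b u₂ v₂ → Y a b ≡ true
      back (inj₂ (inj₁ s)) = from (Y⊨ a b) (inj₁ (here s))
      back (inj₂ (inj₂ s)) = from (Y⊨ a b) (inj₁ (there (here s)))
      back (inj₁ (h , ¬s₁ , ¬s₂)) with to (X⊨ a b) h
      ... | inj₁ (here s) = ⊥-elim (¬s₁ s)
      ... | inj₁ (there (here s)) = ⊥-elim (¬s₂ s)
      ... | inj₁ (there (there j)) = from (Y⊨ a b) (inj₁ (there (there j)))
      ... | inj₂ β = from (Y⊨ a b) (inj₂ β)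

  -- Quantifying over all realisations sidesteps function extensionality: Reach only
  -- identifies graphs pointwise.
  infix 4 _⇝_
  _⇝_ : List (Fin n × Fin n) → List (Fin n × Fin n) → Set
  es ⇝ es′ = ∀ {X Y} → X ⊨ es → Y ⊨ es′ → Reach X Y

  ⇝-refl : es ⇝ es
  ⇝-refl X⊨ Y⊨ = done (⊨-unique X⊨ Y⊨)

  ⇝-trans : ∀ {es″} → es ⇝ es′ → es′ ⇝ es″ → es ⇝ es″
  ⇝-trans p q X⊨ Z⊨ = Reach-trans (p X⊨ graph-⊨) λ M≗ → q (⊨-resp-≗ M≗ graph-⊨) Z⊨

  ⇝-resp-≈ : ∀ {fs fs′} → es ≈ fs → es′ ≈ fs′ → fs ⇝ fs′ → es ⇝ es′
  ⇝-resp-≈ e e′ p X⊨ Y⊨ = p (⊨-resp-≈ e X⊨) (⊨-resp-≈ e′ Y⊨)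

module CycleSwitching {n k : ℕ} (G : Graph n) (G-sym : ∀ a b → G a b ≡ G b a)
                      (v : Fin k → Fin n) (induced : InducedCycle G v) (6≤k : 6 ≤ k) where

  private
    variable
      X Y : Graph n
      a b q x y c z w : Fin n
      W : List (Fin n)
      rest : List (Fin n × Fin n)

  U : List (Fin n)
  U = tabulate v

  OffCycle : Fin n → Fin n → Set
  OffCycle a b = G a b ≡ true × ¬ CycleEdge v a b

  offCycle? : ∀ a b → Dec (OffCycle a b)
  offCycle? a b = (G a b ≟ᵇ true) ×-dec ¬? (cycleEdge? v a b)

  OffCycle-sym : OffCycle a b → OffCycle b a
  OffCycle-sym {a} {b} (g , ¬e) = trans (G-sym b a) g , ¬e ∘ CycleEdge-sym

  ¬OffCycle-within-U : a ∈ U → b ∈ U → ¬ OffCycle a b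
  ¬OffCycle-within-U a∈U b∈U (g , ¬e) with ∈-tabulate⁻ a∈U | ∈-tabulate⁻ b∈U
  ... | i , refl | j , refl with to (proj₂ induced i j) g
  ...   | inj₁ refl = ¬e (i , inj₁ (refl , refl))
  ...   | inj₂ refl = ¬e (j , inj₂ (refl , refl))

  CycleEdge⇒G : CycleEdge v a b → G a b ≡ true
  CycleEdge⇒G (i , inj₁ (refl , refl)) = from (proj₂ induced i (next i)) (inj₁ refl)
  CycleEdge⇒G (i , inj₂ (refl , refl)) = from (proj₂ induced (next i) i) (inj₂ refl)

  open Realisation OffCycle offCycle?

  Absent-within-U : x ∈ U → y ∈ U → ¬ Joins rest x y → Absent x y rest
  Absent-within-U x∈U y∈U ¬j (inj₁ (refl , refl)) = Sum.[ ¬j , ¬OffCycle-within-U x∈U y∈U ]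
  Absent-within-U x∈U y∈U ¬j (inj₂ (refl , refl)) = Sum.[ ¬j ∘ Joins-sym , ¬OffCycle-within-U y∈U x∈U ]

  Good : List (Fin n) → Set
  Good l = l ↭ U

  Good⇒Unique : ∀ {l} → Good l → Unique l
  Good⇒Unique good = PermutationSetoid.Unique-resp-↭ (setoid (Fin n)) (↭⇒↭ₛ (↭-sym good))
                       (Unique.tabulate⁺ (proj₁ induced _ _))

  Good⇒6≤length : ∀ {l} → Good l → 6 ≤ length l
  Good⇒6≤length good = subst (6 ≤_) (sym (trans (↭-length good) (length-tabulate v))) 6≤k

  split-triangle : Good (q ∷ x ∷ y ∷ c ∷ z ∷ w ∷ W) →
                   X ⊨ ring (q ∷ x ∷ y ∷ c ∷ z ∷ w ∷ W) →
                   Y ⊨ ring (x ∷ y ∷ [ c ]) ++ ring (q ∷ z ∷ w ∷ W) →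
                   ΔPlus X Y
  split-triangle {q} {x} {y} {c} {z} {w} {W} good X⊨ Y⊨ with Good⇒Unique good
  ... | (q≢x ∷ q≢y ∷ q≢c ∷ q≢z ∷ q≢w ∷ _) ∷ (x≢y ∷ x≢c ∷ x≢z ∷ x≢w ∷ x∉W) ∷
        (y≢c ∷ y≢z ∷ _) ∷ (c≢z ∷ c≢w ∷ c∉W) ∷ (z≢w ∷ z∉W) ∷ _ =
    y , x , q , c , z ,
    (≢-sym x≢y , ≢-sym q≢y , y≢c , y≢z , ≢-sym q≢x , x≢c , x≢z , q≢c , q≢z , c≢z) ,
    ⊨-edge X⊨ (here (inj₁ (refl , refl))) ,
    ⊨-edge X⊨ (there (here (inj₁ (refl , refl)))) ,
    ⊨-edge X⊨ (there (there (here (inj₁ (refl , refl))))) ,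
    ⊨-edge X⊨ (there (there (there (here (inj₁ (refl , refl)))))) ,
    ⊨-nonEdge X⊨ ¬xc (¬OffCycle-within-U x∈U c∈U) ,
    ⊨-nonEdge X⊨ ¬qz (¬OffCycle-within-U q∈U z∈U) ,
    ⊨-switch (⊨-resp-≈ cycle≈ X⊨) (⊨-resp-≈ split≈ Y⊨)
             (Absent-within-U x∈U q∈U ¬xq) (Absent-within-U c∈U z∈U ¬cz)
    where
      path : List (Fin n × Fin n)
      path = zip (w ∷ W) (W ∷ʳ q)

      kept : List (Fin n × Fin n)
      kept = (x , y) ∷ (y , c) ∷ (z , w) ∷ path

      cycle≈ : ring (q ∷ x ∷ y ∷ c ∷ z ∷ w ∷ W) ≈ (x , q) ∷ (c , z) ∷ kept
      cycle≈ = ≈-trans ≈-flip (≈-∷ (↭⇒≈ (shift (c , z) ((x , y) ∷ (y , c) ∷ []) ((z , w) ∷ path))))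

      split≈ : ring (x ∷ y ∷ [ c ]) ++ ring (q ∷ z ∷ w ∷ W) ≈ (x , c) ∷ (q , z) ∷ kept
      split≈ = ≈-trans (≈-∷ (≈-∷ ≈-flip))
                       (↭⇒≈ (shifts ((x , y) ∷ (y , c) ∷ []) ((x , c) ∷ (q , z) ∷ [])))

      path-avoids : ∀ {t} {Q : Fin n × Fin n → Set} → t ≢ w → All (t ≢_) W → t ≢ q →
                    (∀ {r s} → t ≢ r → t ≢ s → Q (r , s)) → All Q path
      path-avoids t≢w t∉W t≢q apart = zip-All apart (t≢w ∷ t∉W) (++⁺ t∉W (t≢q ∷ []))

      ¬xc : ¬ Joins (ring (q ∷ x ∷ y ∷ c ∷ z ∷ w ∷ W)) x c
      ¬xc = All¬⇒¬Any (apartʳ (≢-sym q≢c) (≢-sym x≢c) ∷ apartʳ (≢-sym x≢c) (≢-sym y≢c) ∷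
                       apartˡ x≢y x≢c ∷ apartˡ x≢c x≢z ∷ apartˡ x≢z x≢w ∷
                       path-avoids x≢w x∉W (≢-sym q≢x) apartˡ)

      ¬qz : ¬ Joins (ring (q ∷ x ∷ y ∷ c ∷ z ∷ w ∷ W)) q z
      ¬qz = All¬⇒¬Any (apartʳ (≢-sym q≢z) (≢-sym x≢z) ∷ apartˡ q≢x q≢y ∷ apartˡ q≢y q≢c ∷
                       apartˡ q≢c q≢z ∷ apartˡ q≢z q≢w ∷
                       path-avoids z≢w z∉W (≢-sym q≢z) apartʳ)

      ¬xq : ¬ Joins kept x q
      ¬xq = All¬⇒¬Any (apartʳ q≢x q≢y ∷ apartˡ x≢y x≢c ∷ apartˡ x≢z x≢w ∷
                       path-avoids x≢w x∉W (≢-sym q≢x) apartˡ)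

      ¬cz : ¬ Joins kept c z
      ¬cz = All¬⇒¬Any (apartˡ (≢-sym x≢c) (≢-sym y≢c) ∷ apartʳ (≢-sym y≢z) (≢-sym c≢z) ∷
                       apartˡ c≢z c≢w ∷ path-avoids c≢w c∉W (≢-sym q≢c) apartˡ)

      q∈U : q ∈ U
      q∈U = ∈-resp-↭ good (here refl)

      x∈U : x ∈ U
      x∈U = ∈-resp-↭ good (there (here refl))

      c∈U : c ∈ U
      c∈U = ∈-resp-↭ good (there (there (there (here refl))))

      z∈U : z ∈ U
      z∈U = ∈-resp-↭ good (there (there (there (there (here refl)))))

  swap-adjacent : Good (q ∷ x ∷ y ∷ c ∷ z ∷ w ∷ W) →
                  ring (q ∷ x ∷ y ∷ c ∷ z ∷ w ∷ W) ⇝ ring (q ∷ y ∷ x ∷ c ∷ z ∷ w ∷ W)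
  swap-adjacent {q} {x} {y} {c} {z} {w} {W} good X⊨ Y⊨ =
    step (inj₁ (split-triangle good X⊨ graph-⊨))
      (step (inj₂ (ΔPlus⇒ΔMinus (⊨-symmetric OffCycle-sym Y⊨) (split-triangle good′ Y⊨ M⊨)))
        (done λ _ _ → refl))
    where
      good′ : Good (q ∷ y ∷ x ∷ c ∷ z ∷ w ∷ W)
      good′ = ↭-trans (↭-prep q (↭-swap y x ↭-refl)) good

      M⊨ : graph (ring (x ∷ y ∷ [ c ]) ++ ring (q ∷ z ∷ w ∷ W)) ⊨
           ring (y ∷ x ∷ [ c ]) ++ ring (q ∷ z ∷ w ∷ W)
      M⊨ = ⊨-resp-≈ (triangle-reverse x y c _) graph-⊨

  swap-front : ∀ x y R → Good (x ∷ y ∷ R) → ring (x ∷ y ∷ R) ⇝ ring (y ∷ x ∷ R)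
  swap-front x y R good with initLast R | Good⇒6≤length good
  ... | (c ∷ z ∷ w ∷ W) ∷ʳ′ q | _ =
    ⇝-resp-≈ (↭⇒≈ (ring-++-comm (x ∷ y ∷ c ∷ z ∷ w ∷ W) [ q ]))
             (↭⇒≈ (ring-++-comm (y ∷ x ∷ c ∷ z ∷ w ∷ W) [ q ]))
             (swap-adjacent (↭-trans (++-comm [ q ] (x ∷ y ∷ c ∷ z ∷ w ∷ W)) good))
  ... | [] | s≤s (s≤s ())
  ... | [] ∷ʳ′ _ | s≤s (s≤s (s≤s ()))
  ... | (_ ∷ []) ∷ʳ′ _ | s≤s (s≤s (s≤s (s≤s ())))
  ... | (_ ∷ _ ∷ []) ∷ʳ′ _ | s≤s (s≤s (s≤s (s≤s (s≤s ()))))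

  swap-at : ∀ pre x y T → Good (pre ++ x ∷ y ∷ T) → ring (pre ++ x ∷ y ∷ T) ⇝ ring (pre ++ y ∷ x ∷ T)
  swap-at pre x y T good =
    ⇝-resp-≈ (↭⇒≈ (ring-++-comm pre (x ∷ y ∷ T))) (↭⇒≈ (ring-++-comm pre (y ∷ x ∷ T)))
             (swap-front x y (T ++ pre) (↭-trans (++-comm (x ∷ y ∷ T) pre) good))

  reassociate : ∀ pre mid {xs ys} →
                (Good ((pre ++ mid) ++ xs) → ring ((pre ++ mid) ++ xs) ⇝ ring ((pre ++ mid) ++ ys)) →
                Good (pre ++ mid ++ xs) → ring (pre ++ mid ++ xs) ⇝ ring (pre ++ mid ++ ys)
  reassociate pre mid {xs} {ys} h rewrite ++-assoc pre mid xs | ++-assoc pre mid ys = h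

  ↭⇒⇝ : ∀ {xs ys} → xs ↭ ys → ∀ pre → Good (pre ++ xs) → ring (pre ++ xs) ⇝ ring (pre ++ ys)
  ↭⇒⇝ ↭.refl pre good = ⇝-refl
  ↭⇒⇝ (↭.prep x p) pre = reassociate pre [ x ] (↭⇒⇝ p (pre ∷ʳ x))
  ↭⇒⇝ (↭.swap x y p) pre good =
    ⇝-trans (swap-at pre x y _ good)
            (reassociate pre (y ∷ x ∷ []) (↭⇒⇝ p (pre ++ y ∷ x ∷ []))
                         (↭-trans (++⁺ˡ pre (↭-swap y x ↭-refl)) good))
  ↭⇒⇝ (↭.trans p p′) pre good =
    ⇝-trans (↭⇒⇝ p pre good) (↭⇒⇝ p′ pre (↭-trans (++⁺ˡ pre (↭-sym p)) good))

  G⊨ring : G ⊨ ring U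
  G⊨ring a b = mk⇔ forth back
    where
      forth : G a b ≡ true → Joins (ring U) a b ⊎ OffCycle a b
      forth g with cycleEdge? v a b
      ... | yes e = inj₁ (from (Joins-ring-tabulate v) e)
      ... | no ¬e = inj₂ (g , ¬e)

      back : Joins (ring U) a b ⊎ OffCycle a b → G a b ≡ true
      back (inj₁ j) = CycleEdge⇒G (to (Joins-ring-tabulate v) j)
      back (inj₂ (g , _)) = g

  ReplaceCycle⇒⊨ : ∀ (u : Fin k → Fin n) {H} → ReplaceCycle G v u H → H ⊨ ring (tabulate u)
  ReplaceCycle⇒⊨ u replace a b = mk⇔
    (Sum.swap ∘ Sum.map₂ (from (Joins-ring-tabulate u)) ∘ to (replace a b))
    (from (replace a b) ∘ Sum.swap ∘ Sum.map₁ (to (Joins-ring-tabulate u)))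

  permute : (σ : Permutation′ k) {H : Graph n} → ReplaceCycle G v (λ i → v (σ ⟨$⟩ʳ i)) H → Reach G H
  permute σ replace = ↭⇒⇝ (tabulate-↭ σ v) [] ↭-refl G⊨ring (ReplaceCycle⇒⊨ _ replace)

lemma5p1 : (n d : ℕ) (G : Graph n) → IsSimple G → Regular d G →
           (k : ℕ) → 6 ≤ k → (v : Fin k → Fin n) → InducedCycle G v →
           (σ : Permutation′ k) → (H : Graph n) →
           ReplaceCycle G v (λ i → v (σ ⟨$⟩ʳ i)) H → Reach G H
lemma5p1 n d G (G-sym , _) _ k 6≤k v induced σ H replace =
  CycleSwitching.permute G G-sym v induced 6≤k σ replace
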